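{- Let $R$, $P$, $Q$ be multi-sets of integers from $[1,w]$. Suppose that $\mathcal{S}(P)$ contains an arithmetic progression $(a_1,\dots,a_k)$ with common difference $\Delta\ge 1$, that $\mathcal{S}(R)\bmod \Delta=[0,\Delta-1]$, and that $k\ge \sigma(R)+w+1$. Then $[\sigma(R)+a_k,\ \sigma(Q)]\subseteq \mathcal{S}(R\cup P\cup Q)$, where $R\cup P\cup Q$ denotes the multi-set union.
   Context: For integers $a\le b$, $[a,b]=\{z\in\mathbb{Z}: a\le z\le b\}$ (empty if $a>b$). For a multi-set $Z$, $\sigma(Z)=\sum_{z\in Z}z$, $\mathcal{S}(Z)=\{\sigma(Y):Y\subseteq Z\}$, and $Z\bmod b=\{z\bmod b:z\in Z\}$ as a set. -}

module Defs where

open import Data.Nat using (ℕ; zero; suc; _+_; _*_; _≤_; _<_; NonZero)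
open import Data.Nat.DivMod using (_%_)
open import Data.List using (List; []; _∷_)
open import Data.Nat.ListAction using (sum)
open import Data.List.Relation.Unary.All using (All)
open import Data.Product using (_×_; ∃-syntax)
open import Relation.Binary.PropositionalEquality using (_≡_)

-- Multi-sets of integers are represented as lists (order irrelevant).
-- σ(Z) = sum of the elements of Z.
σ : List ℕ → ℕ
σ = sum

-- InS Z s  :  s ∈ 𝒮(Z), i.e. s = σ(Y) for some sub-multiset Y ⊆ Z.
-- Each element of Z is either taken or skipped.
data InS : List ℕ → ℕ → Set where
  nil  : InS [] 0
  skip : ∀ {z zs s} → InS zs s → InS (z ∷ zs) s
  take : ∀ {z zs s} → InS zs s → InS (z ∷ zs) (z + s)

InRange : ℕ → List ℕ → Set
InRange w Z = All (λ z → 1 ≤ z × z ≤ w) Z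

-- 𝒮(Z) mod Δ = [0, Δ-1]  (as sets)
SumsModCover : (Z : List ℕ) (Δ : ℕ) .{{_ : NonZero Δ}} → Set
SumsModCover Z Δ = ∀ r → (r < Δ → ∃[ s ] (InS Z s × s % Δ ≡ r))
                        × ((∃[ s ] (InS Z s × s % Δ ≡ r)) → r < Δ)

{-# OPTIONS --safe #-}
module Submission where

-- 𝒮(R ∪ P) contains the whole interval [a + σ(R), a_k]: for u ∈ [σ(R), (k-1)Δ] choose
-- s ∈ 𝒮(R) with s ≡ u (mod Δ); then u - s = iΔ with i < k, so a + u = s + a_{i+1}.
-- As k - 1 ≥ σ(R) + w, this interval has length at least w.  Elements of Q are at
-- most w, so every L ≤ σ(Q) lies at most w below some subset sum L + e of Q, and
-- x = (a_k - e) + (L + e) with L = x - a_k covers [a_k, a_k + σ(Q)] ⊇ [σ(R) + a_k, σ(Q)].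

open import Defs
open import Data.Nat using (ℕ; zero; suc; _+_; _*_; _∸_; _≤_; _<_; NonZero; z≤n; s≤s; s≤s⁻¹; _≤?_)
open import Data.Nat.Properties
open import Data.Nat.DivMod using (_%_; _/_; m≡m%n+[m/n]*n; m%n<n)
open import Data.List using (List; []; _∷_; _++_)
open import Data.List.Properties using (++-assoc)
open import Data.List.Relation.Unary.All as All using (All; []; _∷_)
open import Data.Product using (_×_; _,_; proj₁; proj₂; ∃-syntax)
open import Relation.Nullary using (yes; no)
open import Relation.Binary.PropositionalEquality using (_≡_; sym; cong; cong₂; subst; module ≡-Reasoning)

[_,_]⊆𝒮_ : ℕ → ℕ → List ℕ → Set
[ lo , hi ]⊆𝒮 Z = ∀ x → lo ≤ x → x ≤ hi → InS Z x

InS-σ : ∀ Z → InS Z (σ Z)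
InS-σ []       = nil
InS-σ (z ∷ zs) = take (InS-σ zs)

InS⇒≤σ : ∀ {Z s} → InS Z s → s ≤ σ Z
InS⇒≤σ nil            = z≤n
InS⇒≤σ (skip {z} sum) = ≤-trans (InS⇒≤σ sum) (m≤n+m _ z)
InS⇒≤σ (take {z} sum) = +-monoʳ-≤ z (InS⇒≤σ sum)

InS-++ : ∀ {A B s t} → InS A s → InS B t → InS (A ++ B) (s + t)
InS-++ nil          B-sum = B-sum
InS-++ (skip A-sum) B-sum = skip (InS-++ A-sum B-sum)
InS-++ {t = t} (take {z} {s = s} A-sum) B-sum =
  subst (InS _) (sym (+-assoc z s t)) (take (InS-++ A-sum B-sum))

InS-within : ∀ {w Q} → All (_≤ w) Q → ∀ L → L ≤ σ Q → ∃[ e ] (e ≤ w × InS Q (L + e))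
InS-within [] zero z≤n = 0 , z≤n , nil
InS-within {w} {z ∷ zs} (z≤w ∷ zs≤w) L L≤σQ with L ≤? σ zs
... | yes L≤σzs = let (e , e≤w , zs-sum) = InS-within zs≤w L L≤σzs in e , e≤w , skip zs-sum
... | no  L≰σzs =
  z + σ zs ∸ L , e≤w , subst (InS (z ∷ zs)) (sym (m+[n∸m]≡n L≤σQ)) (InS-σ (z ∷ zs))
  where
  e≤w : z + σ zs ∸ L ≤ w
  e≤w = begin
    z + σ zs ∸ L     ≤⟨ ∸-monoʳ-≤ (z + σ zs) (≰⇒≥ L≰σzs) ⟩
    z + σ zs ∸ σ zs  ≡⟨ m+n∸n≡m z (σ zs) ⟩
    z                ≤⟨ z≤w ⟩
    w                ∎
    where open ≤-Reasoning

m%d≡n%d⇒m∸n≡[m/d∸n/d]*d : ∀ m n d .{{_ : NonZero d}} → m % d ≡ n % d → m ∸ n ≡ (m / d ∸ n / d) * d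
m%d≡n%d⇒m∸n≡[m/d∸n/d]*d m n d m%d≡n%d = begin
  m ∸ n                                    ≡⟨ cong₂ _∸_ (m≡m%n+[m/n]*n m d) (m≡m%n+[m/n]*n n d) ⟩
  (m % d + m / d * d) ∸ (n % d + n / d * d) ≡⟨ cong (λ r → (m % d + m / d * d) ∸ (r + n / d * d)) (sym m%d≡n%d) ⟩
  (m % d + m / d * d) ∸ (m % d + n / d * d) ≡⟨ [m+n]∸[m+o]≡n∸o (m % d) _ _ ⟩
  m / d * d ∸ n / d * d                    ≡⟨ sym (*-distribʳ-∸ d (m / d) (n / d)) ⟩
  (m / d ∸ n / d) * d                      ∎
  where open ≡-Reasoning

InS-residue : ∀ {R Δ} .{{_ : NonZero Δ}} →
              (∀ r → r < Δ → ∃[ s ] (InS R s × s % Δ ≡ r)) →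
              ∀ u → σ R ≤ u → ∃[ s ] ∃[ i ] (InS R s × s + i * Δ ≡ u)
InS-residue {R} {Δ} hits u σR≤u =
  let (s , R-sum , s≡u) = hits (u % Δ) (m%n<n u Δ)
      s≤u = ≤-trans (InS⇒≤σ R-sum) σR≤u
  in  s , u / Δ ∸ s / Δ , R-sum ,
      (begin
        s + (u / Δ ∸ s / Δ) * Δ  ≡⟨ cong (s +_) (sym (m%d≡n%d⇒m∸n≡[m/d∸n/d]*d u s Δ (sym s≡u))) ⟩
        s + (u ∸ s)              ≡⟨ m+[n∸m]≡n s≤u ⟩
        u                        ∎)
  where open ≡-Reasoning

progression-sums : ∀ {R P Δ a m} .{{_ : NonZero Δ}} →
                   (∀ r → r < Δ → ∃[ s ] (InS R s × s % Δ ≡ r)) →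
                   (∀ i → i ≤ m → InS P (a + i * Δ)) →
                   [ a + σ R , a + m * Δ ]⊆𝒮 (R ++ P)
progression-sums {R} {P} {Δ} {a} {m} hits progression t a+σR≤t t≤a+mΔ =
  let (s , i , R-sum , s+iΔ≡u) = InS-residue hits u σR≤u
      i≤m = *-cancelʳ-≤ i m Δ (≤-trans (m≤n+m (i * Δ) s) (≤-trans (≤-reflexive s+iΔ≡u) u≤mΔ))
  in  subst (InS (R ++ P)) (t≡ s i s+iΔ≡u) (InS-++ R-sum (progression i i≤m))
  where
  open ≡-Reasoning
  u = t ∸ a
  σR≤u : σ R ≤ u
  σR≤u = m+n≤o⇒m≤o∸n (σ R) (≤-trans (≤-reflexive (+-comm (σ R) a)) a+σR≤t)
  u≤mΔ : u ≤ m * Δ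
  u≤mΔ = ≤-trans (∸-monoˡ-≤ a t≤a+mΔ) (≤-reflexive (m+n∸m≡n a (m * Δ)))
  t≡ : ∀ s i → s + i * Δ ≡ u → s + (a + i * Δ) ≡ t
  t≡ s i s+iΔ≡u = begin
    s + (a + i * Δ)  ≡⟨ sym (+-assoc s a (i * Δ)) ⟩
    s + a + i * Δ    ≡⟨ cong (_+ i * Δ) (+-comm s a) ⟩
    a + s + i * Δ    ≡⟨ +-assoc a s (i * Δ) ⟩
    a + (s + i * Δ)  ≡⟨ cong (a +_) s+iΔ≡u ⟩
    a + (t ∸ a)      ≡⟨ m+[n∸m]≡n (m+n≤o⇒m≤o a a+σR≤t) ⟩
    t                ∎

window-extend : ∀ {w A Q lo hi} → All (_≤ w) Q → lo + w ≤ hi →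
                [ lo , hi ]⊆𝒮 A → [ hi , hi + σ Q ]⊆𝒮 (A ++ Q)
window-extend {w} {A} {Q} {lo} {hi} Q≤w lo+w≤hi A-interval x hi≤x x≤hi+σQ =
  let (e , e≤w , Q-sum) = InS-within Q≤w (x ∸ hi) L≤σQ in split e e≤w Q-sum
  where
  open ≡-Reasoning
  L≤σQ : x ∸ hi ≤ σ Q
  L≤σQ = ≤-trans (∸-monoˡ-≤ hi x≤hi+σQ) (≤-reflexive (m+n∸m≡n hi (σ Q)))
  split : ∀ e → e ≤ w → InS Q (x ∸ hi + e) → InS (A ++ Q) x
  split e e≤w Q-sum = subst (InS (A ++ Q)) x≡ (InS-++ (A-interval (hi ∸ e) lo≤hi∸e (m∸n≤m hi e)) Q-sum)
    where
    lo+e≤hi : lo + e ≤ hi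
    lo+e≤hi = ≤-trans (+-monoʳ-≤ lo e≤w) lo+w≤hi
    lo≤hi∸e : lo ≤ hi ∸ e
    lo≤hi∸e = m+n≤o⇒m≤o∸n lo lo+e≤hi
    x≡ : hi ∸ e + (x ∸ hi + e) ≡ x
    x≡ = begin
      hi ∸ e + (x ∸ hi + e)   ≡⟨ cong (hi ∸ e +_) (+-comm (x ∸ hi) e) ⟩
      hi ∸ e + (e + (x ∸ hi)) ≡⟨ sym (+-assoc (hi ∸ e) e (x ∸ hi)) ⟩
      hi ∸ e + e + (x ∸ hi)   ≡⟨ cong (_+ (x ∸ hi)) (m∸n+n≡m (m+n≤o⇒n≤o lo lo+e≤hi)) ⟩
      hi + (x ∸ hi)           ≡⟨ m+[n∸m]≡n hi≤x ⟩
      x                       ∎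

-- a_i = a + (i-1)Δ and k = suc m, so a_k = a + m * Δ.
lemma5 : (w : ℕ) (R P Q : List ℕ) (a Δ m : ℕ) .{{_ : NonZero Δ}} →
         InRange w R → InRange w P → InRange w Q →
         (∀ i → i < suc m → InS P (a + i * Δ)) →
         SumsModCover R Δ →
         σ R + w + 1 ≤ suc m →
         ∀ x → σ R + (a + m * Δ) ≤ x → x ≤ σ Q → InS (R ++ P ++ Q) x
lemma5 w R P Q a Δ m _ _ Q-range progression cover k-large x σR+aₖ≤x x≤σQ =
  subst (λ Z → InS Z x) (++-assoc R P Q)
    (window-extend (All.map proj₂ Q-range) gap
      (progression-sums (λ r → proj₁ (cover r)) (λ i i≤m → progression i (s≤s i≤m)))
      x (m+n≤o⇒n≤o (σ R) σR+aₖ≤x) (≤-trans x≤σQ (m≤n+m (σ Q) (a + m * Δ))))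
  where
  σR+w≤m : σ R + w ≤ m
  σR+w≤m = s≤s⁻¹ (subst (_≤ suc m) (+-comm (σ R + w) 1) k-large)
  gap : a + σ R + w ≤ a + m * Δ
  gap = ≤-trans (≤-reflexive (+-assoc a (σ R) w)) (+-monoʳ-≤ a (≤-trans σR+w≤m (m≤m*n m Δ)))
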